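{- A graph $G$ has $\sigma(G) = 3$ if and only if $3 \le \chi(G) \le 4$, and $\sigma(G) = 4$ if and only if $5 \le \chi(G) \le 12$.
   Context: $\chi(G)$ is the chromatic number of $G$. An orientation covering of $G$ is a set of orientations $\overrightarrow{G_1},\dots,\overrightarrow{G_k}$ of $G$ such that for every vertex $u$ and any two distinct neighbors $v,w$ of $u$, some $\overrightarrow{G_i}$ contains both arcs $\overrightarrow{uv}$ and $\overrightarrow{uw}$. $\sigma(G)$ is the minimum size of an orientation covering of $G$. -}

module Defs where

open import Data.Nat using (ℕ; _<_)
open import Data.Fin using (Fin)
open import Data.Bool using (Bool; true; false)
open import Data.Product using (Σ; _×_; ∃)
open import Data.Sum using (_⊎_)
open import Relation.Binary.PropositionalEquality using (_≡_; _≢_)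
open import Relation.Nullary using (¬_)

record Graph (n : ℕ) : Set where
  field
    adj     : Fin n → Fin n → Bool
    symm    : ∀ u v → adj u v ≡ adj v u
    irrefl  : ∀ u → adj u u ≡ false
open Graph public

record Colouring {n : ℕ} (G : Graph n) (k : ℕ) : Set where
  field
    colour : Fin n → Fin k
    proper : ∀ u v → adj G u v ≡ true → colour u ≢ colour v

IsChromaticNumber : {n : ℕ} → Graph n → ℕ → Set
IsChromaticNumber G k = Colouring G k × (∀ m → m < k → ¬ Colouring G m)

record Orientation {n : ℕ} (G : Graph n) : Set where
  field
    arc      : Fin n → Fin n → Bool
    onEdges  : ∀ u v → arc u v ≡ true → adj G u v ≡ true
    directed : ∀ u v → adj G u v ≡ true →
               (arc u v ≡ true × arc v u ≡ false) ⊎ (arc u v ≡ false × arc v u ≡ true)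
open Orientation public

record OrientationCovering {n : ℕ} (G : Graph n) (k : ℕ) : Set where
  field
    orient : Fin k → Orientation G
    covers : ∀ u v w → adj G u v ≡ true → adj G u w ≡ true → v ≢ w →
             Σ (Fin k) λ i → (arc (orient i) u v ≡ true × arc (orient i) u w ≡ true)

IsSigma : {n : ℕ} → Graph n → ℕ → Set
IsSigma G k = OrientationCovering G k × (∀ m → m < k → ¬ OrientationCovering G m)

module Submission where

-- Both follow from  σ(G) ≤ k ⇔ χ(G) ≤ f  for (k , f) = (2,2), (3,4), (4,12), f being the
-- number of maximal intersecting families on a k-set.  These form a complete system
-- (CompleteSystem): intersecting families, pairwise separated by a set and its complement,
-- and together absorbing every intersecting family.
--   * Covering ⇒ colouring: the sets out(u,v) of orientations in which edge uv leaves u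
--     satisfy out(v,u) = ∁ out(u,v) and are pairwise intersecting at u; colour u by a family
--     absorbing them (a degenerate pendant case is recoloured by hand).
--   * Colouring ⇒ covering: orient edges between colour classes by the separators.
-- The systems are weighted majority families, intersecting by a weight count; separation
-- and completeness are finite checks.  Decidability of colourability then produces χ(G),
-- and monotonicity turns the two inequalities into the stated bands (sigma-band).

open import Defs
open import Data.Nat using (ℕ; _≤_)
open import Data.Product using (_×_; ∃)
open import Function.Bundles using (_⇔_)

open import Data.Nat as ℕ using (zero; suc; _+_; _*_; _<_; _≤′_; ≤′-refl; ≤′-step; z≤n)
import Data.Nat.Properties as ℕP
open import Data.Fin as Fin using (Fin; zero; suc)
import Data.Fin.Properties as FinP
open import Data.Fin.Subset using (Subset; _∈_; _∩_; ∁; Nonempty; Empty) renaming (⊥ to ∅)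
open import Data.Fin.Subset.Properties using (nonempty?; anySubset?; x∈p∩q⁺; x∈p∩q⁻; x∈p⇒x∉∁p; x∉p⇒x∈∁p)
open import Data.Bool as Bool using (Bool; true; false; not; _∧_; _∨_; if_then_else_)
open import Data.Bool.Properties using (not-involutive; ∨-zeroʳ)
open import Data.Vec as Vec using (Vec; []; _∷_; lookup; tabulate; here; there)
import Data.Vec.Properties as VecP
open import Data.List using (List; []; _∷_; allFin)
open import Data.List.Relation.Unary.All as All using (All; []; _∷_)
open import Data.Product using (_,_; proj₁; proj₂)
open import Data.Sum using (_⊎_; inj₁; inj₂)
open import Data.Empty using (⊥-elim)
open import Data.Unit using (tt)
open import Function using (_∘_)
open import Function.Bundles using (Equivalence; mk⇔)
open import Relation.Nullary using (¬_; Dec; yes; no; does; contradiction)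
open import Relation.Nullary.Decidable using (True; toWitness; map′; ¬?; _×-dec_; _→-dec_; dec-true; dec-false; decidable-stable)
open import Relation.Unary using (Decidable)
open import Relation.Binary.Definitions using (tri<; tri≈; tri>)
open import Relation.Binary.PropositionalEquality

_meets_ : ∀ {k} → Subset k → Subset k → Set
S meets T = Nonempty (S ∩ T)

meets? : ∀ {k} (S T : Subset k) → Dec (S meets T)
meets? S T = nonempty? (S ∩ T)

nonempty-meets-itself : ∀ {k} {S : Subset k} → Nonempty S → S meets S
nonempty-meets-itself (i , i∈S) = i , x∈p∩q⁺ (i∈S , i∈S)

meets⇒nonemptyˡ : ∀ {k} {S T : Subset k} → S meets T → Nonempty S
meets⇒nonemptyˡ {S = S} {T} (i , i∈S∩T) = i , proj₁ (x∈p∩q⁻ S T i∈S∩T)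

meets⇒nonemptyʳ : ∀ {k} {S T : Subset k} → S meets T → Nonempty T
meets⇒nonemptyʳ {S = S} {T} (i , i∈S∩T) = i , proj₂ (x∈p∩q⁻ S T i∈S∩T)

meets-∷ : ∀ {k} b c {S T : Subset k} → S meets T → (b ∷ S) meets (c ∷ T)
meets-∷ _ _ (i , i∈S∩T) = suc i , there i∈S∩T

complement-disjoint : ∀ {k} (S : Subset k) → ¬ (S meets ∁ S)
complement-disjoint S (i , i∈S∩∁S) = x∈p⇒x∉∁p i∈S i∈∁S
  where
  i∈S = proj₁ (x∈p∩q⁻ S (∁ S) i∈S∩∁S)
  i∈∁S = proj₂ (x∈p∩q⁻ S (∁ S) i∈S∩∁S)

anySubsetᵇ : ∀ k → (Subset k → Bool) → Bool
anySubsetᵇ zero    p = p []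
anySubsetᵇ (suc k) p = anySubsetᵇ k (p ∘ (true ∷_)) ∨ anySubsetᵇ k (p ∘ (false ∷_))

anySubsetᵇ-intro : ∀ k (p : Subset k → Bool) S → p S ≡ true → anySubsetᵇ k p ≡ true
anySubsetᵇ-intro zero    p []          pS = pS
anySubsetᵇ-intro (suc k) p (true ∷ S)  pS =
  cong (_∨ anySubsetᵇ k (p ∘ (false ∷_))) (anySubsetᵇ-intro k _ S pS)
anySubsetᵇ-intro (suc k) p (false ∷ S) pS =
  trans (cong (anySubsetᵇ k (p ∘ (true ∷_)) ∨_) (anySubsetᵇ-intro k _ S pS)) (∨-zeroʳ _)

record CompleteSystem (k f : ℕ) : Set₁ where
  field
    Member        : Fin f → Subset k → Set
    member?       : ∀ c → Decidable (Member c)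
    intersecting  : ∀ c {S T} → Member c S → Member c T → S meets T
    separator     : Fin f → Fin f → Subset k
    separates     : ∀ {c c'} → c ≢ c' →
                    Member c (separator c c') × Member c' (∁ (separator c c'))
    noTransversal : (W : Fin f → Subset k) → (∀ c c' → W c meets W c') →
                    ¬ (∀ c → ¬ Member c (W c))

refuted-implication : ∀ {A B : Set} → Dec A → ¬ (A → B) → A × ¬ B
refuted-implication A? ¬A→B =
  decidable-stable A? (λ ¬A → ¬A→B (λ a → contradiction a ¬A)) , λ b → ¬A→B (λ _ → b)

module _ {k f} (𝓕 : CompleteSystem k f) where
  open CompleteSystem 𝓕

  complement-free : ∀ c {S} → Member c S → ¬ Member c (∁ S)
  complement-free c {S} S∈c ∁S∈c = complement-disjoint S (intersecting c S∈c ∁S∈c)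

  -- Every intersecting family, given as the sets F i for i in a decidable P ⊆ Fin n, lies
  -- inside a single family of the system: otherwise each family misses some F i, and these
  -- witnesses would form a forbidden transversal.
  absorb : ∀ {n} {P : Fin n → Set} → Decidable P → (F : Fin n → Subset k) →
           (∀ i j → P i → P j → F i meets F j) → ∃ λ c → ∀ i → P i → Member c (F i)
  absorb {n} {P} P? F meet with FinP.any? (λ c → FinP.all? (λ i → P? i →-dec member? c (F i)))
  ... | yes contained = contained
  ... | no ¬contained = ⊥-elim (noTransversal (F ∘ missed) missed-meet missed-outside)
    where
    missing : ∀ c → ∃ λ i → P i × ¬ Member c (F i)
    missing c with FinP.¬∀⟶∃¬ n _ (λ i → P? i →-dec member? c (F i)) (λ all → ¬contained (c , all))
    ... | i , ¬P→F = i , refuted-implication (P? i) ¬P→F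
    missed : Fin f → Fin n
    missed c = proj₁ (missing c)
    missed-meet : ∀ c c' → F (missed c) meets F (missed c')
    missed-meet c c' = meet _ _ (proj₁ (proj₂ (missing c))) (proj₁ (proj₂ (missing c')))
    missed-outside : ∀ c → ¬ Member c (F (missed c))
    missed-outside c = proj₂ (proj₂ (missing c))

-- A Boolean search refuting transversals, so that completeness becomes a finite computation.
module TransversalSearch {k f} (Member : Fin f → Subset k → Set)
                         (member? : ∀ c → Decidable (Member c)) where

  -- search cs chosen: can one choose, for each family c in cs, a set outside c so that all
  -- chosen sets (including those already in 'chosen') pairwise meet?
  search : List (Fin f) → List (Subset k) → Bool
  search []       chosen = true
  search (c ∷ cs) chosen = anySubsetᵇ k λ S →
    not (does (member? c S)) ∧ (does (All.all? (meets? S) (S ∷ chosen)) ∧ search cs (S ∷ chosen))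

  search-finds : (W : Fin f → Subset k) → (∀ c c' → W c meets W c') → (∀ c → ¬ Member c (W c)) →
                 ∀ cs chosen → (∀ c → All (W c meets_) chosen) → search cs chosen ≡ true
  search-finds W meet outside []       chosen _      = refl
  search-finds W meet outside (c ∷ cs) chosen meets-chosen =
    anySubsetᵇ-intro k _ (W c) (cong₂ _∧_ W∉c (cong₂ _∧_ W-meets rest))
    where
    W∉c : not (does (member? c (W c))) ≡ true
    W∉c = cong not (dec-false (member? c (W c)) (outside c))
    W-meets : does (All.all? (meets? (W c)) (W c ∷ chosen)) ≡ true
    W-meets = dec-true (All.all? (meets? (W c)) (W c ∷ chosen)) (meet c c ∷ meets-chosen c)
    rest : search cs (W c ∷ chosen) ≡ true
    rest = search-finds W meet outside cs (W c ∷ chosen) (λ c' → meet c' c ∷ meets-chosen c')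

weight : ∀ {k} → Vec ℕ k → Subset k → ℕ
weight []      []      = 0
weight (x ∷ w) (b ∷ S) = (if b then x else 0) + weight w S

Majority : ∀ {k} → Vec ℕ k → Subset k → Set
Majority w S = Vec.sum w < 2 * weight w S

majority? : ∀ {k} (w : Vec ℕ k) → Decidable (Majority w)
majority? w S = Vec.sum w ℕ.<? 2 * weight w S

disjoint-weight : ∀ {k} (w : Vec ℕ k) S T → ¬ (S meets T) → weight w S + weight w T ≤ Vec.sum w
disjoint-weight []      []      []      _ = z≤n
disjoint-weight (x ∷ w) (true ∷ S) (true ∷ T) disjoint = ⊥-elim (disjoint (zero , here))
disjoint-weight (x ∷ w) (true ∷ S) (false ∷ T) disjoint =
  ℕP.≤-trans (ℕP.≤-reflexive (ℕP.+-assoc x _ _))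
             (ℕP.+-monoʳ-≤ x (disjoint-weight w S T (disjoint ∘ meets-∷ true false)))
disjoint-weight (x ∷ w) (false ∷ S) (true ∷ T) disjoint =
  ℕP.≤-trans (ℕP.≤-reflexive (+-middle (weight w S) x (weight w T)))
             (ℕP.+-monoʳ-≤ x (disjoint-weight w S T (disjoint ∘ meets-∷ false true)))
  where
  +-middle : ∀ a x b → a + (x + b) ≡ x + (a + b)
  +-middle a x b = trans (sym (ℕP.+-assoc a x b)) (trans (cong (_+ b) (ℕP.+-comm a x)) (ℕP.+-assoc x a b))
disjoint-weight (x ∷ w) (false ∷ S) (false ∷ T) disjoint =
  ℕP.≤-trans (disjoint-weight w S T (disjoint ∘ meets-∷ false false)) (ℕP.m≤n+m _ x)

-- Two majorities always meet: disjoint majorities would carry more than the total weight.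
majorities-meet : ∀ {k} (w : Vec ℕ k) {S T} → Majority w S → Majority w T → S meets T
majorities-meet w {S} {T} majS majT with meets? S T
... | yes meet     = meet
... | no  disjoint = ⊥-elim (ℕP.<-irrefl refl too-heavy)
  where
  open ℕP.≤-Reasoning
  W = Vec.sum w
  too-heavy : W + W < W + W
  too-heavy = begin-strict
    W + W                           <⟨ ℕP.+-mono-< majS majT ⟩
    2 * weight w S + 2 * weight w T ≡⟨ sym (ℕP.*-distribˡ-+ 2 (weight w S) (weight w T)) ⟩
    2 * (weight w S + weight w T)   ≤⟨ ℕP.*-monoʳ-≤ 2 (disjoint-weight w S T disjoint) ⟩
    2 * W                           ≡⟨ cong (W +_) (ℕP.+-identityʳ W) ⟩
    W + W                           ∎

module MajoritySystem {k f} (ws : Vec (Vec ℕ k) f) where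
  Member : Fin f → Subset k → Set
  Member c = Majority (lookup ws c)

  member? : ∀ c → Decidable (Member c)
  member? c = majority? (lookup ws c)

  Separated : Fin f → Fin f → Set
  Separated c c' = ∃ λ S → Member c S × Member c' (∁ S)

  separated? : ∀ c c' → Dec (Separated c c')
  separated? c c' = anySubset? λ S → member? c S ×-dec member? c' (∁ S)

  separating? : Dec (∀ c c' → c ≢ c' → Separated c c')
  separating? = FinP.all? λ c → FinP.all? λ c' → ¬? (c FinP.≟ c') →-dec separated? c c'

  open TransversalSearch Member member?

  complete : True separating? → search (allFin f) [] ≡ false → CompleteSystem k f
  complete separating-check no-transversal = record
    { Member        = Member
    ; member?       = member?
    ; intersecting  = λ c → majorities-meet (lookup ws c)
    ; separator     = separator
    ; separates     = separates
    ; noTransversal = λ W meet outside →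
        contradiction (trans (sym no-transversal) (search-finds W meet outside (allFin f) [] (λ _ → []))) λ ()
    }
    where
    separator : Fin f → Fin f → Subset k
    separator c c' with separated? c c'
    ... | yes (S , _) = S
    ... | no  _       = ∅
    separates : ∀ {c c'} → c ≢ c' → Member c (separator c c') × Member c' (∁ (separator c c'))
    separates {c} {c'} c≢c' with separated? c c'
    ... | yes (_ , sep) = sep
    ... | no  ¬sep      = ⊥-elim (¬sep (toWitness separating-check c c' c≢c'))

-- The maximal intersecting families on 2, 3 and 4 points, as weighted majorities:
-- the stars, the majorities on three points and, for four points, the permutations of the
-- weights (2,1,1,1).
system₂ : CompleteSystem 2 2
system₂ = MajoritySystem.complete
  ((1 ∷ 0 ∷ []) ∷ (0 ∷ 1 ∷ []) ∷ []) tt refl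

system₃ : CompleteSystem 3 4
system₃ = MajoritySystem.complete
  ((1 ∷ 0 ∷ 0 ∷ []) ∷ (0 ∷ 1 ∷ 0 ∷ []) ∷ (0 ∷ 0 ∷ 1 ∷ []) ∷ (1 ∷ 1 ∷ 1 ∷ []) ∷ []) tt refl

system₄ : CompleteSystem 4 12
system₄ = MajoritySystem.complete
  ( (1 ∷ 0 ∷ 0 ∷ 0 ∷ []) ∷ (0 ∷ 1 ∷ 0 ∷ 0 ∷ []) ∷ (0 ∷ 0 ∷ 1 ∷ 0 ∷ []) ∷ (0 ∷ 0 ∷ 0 ∷ 1 ∷ [])
  ∷ (0 ∷ 1 ∷ 1 ∷ 1 ∷ []) ∷ (1 ∷ 0 ∷ 1 ∷ 1 ∷ []) ∷ (1 ∷ 1 ∷ 0 ∷ 1 ∷ []) ∷ (1 ∷ 1 ∷ 1 ∷ 0 ∷ [])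
  ∷ (2 ∷ 1 ∷ 1 ∷ 1 ∷ []) ∷ (1 ∷ 2 ∷ 1 ∷ 1 ∷ []) ∷ (1 ∷ 1 ∷ 2 ∷ 1 ∷ []) ∷ (1 ∷ 1 ∷ 1 ∷ 2 ∷ [])
  ∷ []) tt refl

adjacent-distinct : ∀ {n} (G : Graph n) {u v} → adj G u v ≡ true → u ≢ v
adjacent-distinct G {u} uv refl with trans (sym uv) (irrefl G u)
... | ()

adjacent-sym : ∀ {n} (G : Graph n) {u v} → adj G u v ≡ true → adj G v u ≡ true
adjacent-sym G {u} {v} uv = trans (symm G v u) uv

orientBy : ∀ {n} (G : Graph n) (t : Fin n → Fin n → Bool) →
           (∀ u v → adj G u v ≡ true → t v u ≡ not (t u v)) → Orientation G
orientBy G t antisym = record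
  { arc      = λ u v → adj G u v ∧ t u v
  ; onEdges  = λ u v → edge
  ; directed = one-way-on-edges
  }
  where
  edge : ∀ {a b} → a ∧ b ≡ true → a ≡ true
  edge {true} _ = refl
  one-way : ∀ b → (b ≡ true × not b ≡ false) ⊎ (b ≡ false × not b ≡ true)
  one-way true  = inj₁ (refl , refl)
  one-way false = inj₂ (refl , refl)
  one-way-on-edges : ∀ u v → adj G u v ≡ true →
                     (adj G u v ∧ t u v ≡ true × adj G v u ∧ t v u ≡ false) ⊎
                     (adj G u v ∧ t u v ≡ false × adj G v u ∧ t v u ≡ true)
  one-way-on-edges u v uv rewrite uv | adjacent-sym G uv | antisym u v uv = one-way (t u v)

orientBy-arc : ∀ {n} (G : Graph n) t antisym {u v} → adj G u v ≡ true → t u v ≡ true →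
               arc (orientBy G t antisym) u v ≡ true
orientBy-arc G t antisym uv tuv rewrite uv | tuv = refl

<ᵇ-antisym : ∀ {n} {u v : Fin n} → u ≢ v → does (v FinP.<? u) ≡ not (does (u FinP.<? v))
<ᵇ-antisym {u = u} {v} u≢v with FinP.<-cmp u v
... | tri< u<v _ v≮u = trans (dec-false (v FinP.<? u) v≮u) (cong not (sym (dec-true (u FinP.<? v) u<v)))
... | tri≈ _ u≡v _   = ⊥-elim (u≢v u≡v)
... | tri> u≮v _ v<u = trans (dec-true (v FinP.<? u) v<u) (cong not (sym (dec-false (u FinP.<? v) u≮v)))

covering-suc : ∀ {n k} (G : Graph n) → OrientationCovering G k → OrientationCovering G (suc k)
covering-suc G C = record
  { orient = λ { zero → increasing ; (suc i) → orient i }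
  ; covers = λ u v w uv uw v≢w → let (i , arcs) = covers u v w uv uw v≢w in suc i , arcs
  }
  where
  open OrientationCovering C
  increasing : Orientation G
  increasing = orientBy G (λ u v → does (u FinP.<? v)) (λ u v uv → <ᵇ-antisym (adjacent-distinct G uv))

covering-mono : ∀ {n k k'} (G : Graph n) → k ≤ k' → OrientationCovering G k → OrientationCovering G k'
covering-mono G k≤k' = go (ℕP.≤⇒≤′ k≤k')
  where
  go : ∀ {k k'} → k ≤′ k' → OrientationCovering G k → OrientationCovering G k'
  go ≤′-refl        C = C
  go (≤′-step k≤k') C = covering-suc G (go k≤k' C)

colouring-mono : ∀ {n m m'} (G : Graph n) → m ≤ m' → Colouring G m → Colouring G m'
colouring-mono G m≤m' κ = record
  { colour = λ u → Fin.inject≤ (colour u) m≤m'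
  ; proper = λ u v uv same → proper u v uv (FinP.inject≤-injective m≤m' m≤m' _ _ same)
  }
  where open Colouring κ

-- Given an f-colouring and a complete system of f families on k points, orient the edges
-- between colour classes x and y by the separator: the k orientations cover G because the
-- labels at a vertex of colour x all lie in the intersecting family x.
module ColouringToCovering {n k f} {G : Graph n} (𝓕 : CompleteSystem k f) (κ : Colouring G f) where
  open CompleteSystem 𝓕
  open Colouring κ

  -- label x y: the orientations in which an edge from colour x to colour y leaves x.
  label : Fin f → Fin f → Subset k
  label x y = if does (x FinP.<? y) then separator x y else ∁ (separator y x)

  label-member : ∀ {x y} → x ≢ y → Member x (label x y)
  label-member {x} {y} x≢y with does (x FinP.<? y)
  ... | true  = proj₁ (separates x≢y)
  ... | false = proj₂ (separates (x≢y ∘ sym))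

  label-antisym : ∀ {x y} → x ≢ y → ∀ i → lookup (label y x) i ≡ not (lookup (label x y) i)
  label-antisym {x} {y} x≢y i rewrite <ᵇ-antisym x≢y with does (x FinP.<? y)
  ... | true  = VecP.lookup-map i not (separator x y)
  ... | false = sym (trans (cong not (VecP.lookup-map i not (separator y x))) (not-involutive _))

  rule : Fin k → Fin n → Fin n → Bool
  rule i u v = lookup (label (colour u) (colour v)) i

  rule-antisym : ∀ i u v → adj G u v ≡ true → rule i v u ≡ not (rule i u v)
  rule-antisym i u v uv = label-antisym (proper u v uv) i

  orientation : Fin k → Orientation G
  orientation i = orientBy G (rule i) (rule-antisym i)

  covering : OrientationCovering G k
  covering = record { orient = orientation ; covers = covers }
    where
    covers : ∀ u v w → adj G u v ≡ true → adj G u w ≡ true → v ≢ w →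
             ∃ λ i → arc (orientation i) u v ≡ true × arc (orientation i) u w ≡ true
    covers u v w uv uw _ with intersecting (colour u) (label-member (proper u v uv))
                                                      (label-member (proper u w uw))
    ... | i , i∈both = i , orientBy-arc G (rule i) (rule-antisym i) uv (VecP.[]=⇒lookup (proj₁ in-labels))
                         , orientBy-arc G (rule i) (rule-antisym i) uw (VecP.[]=⇒lookup (proj₂ in-labels))
      where in-labels = x∈p∩q⁻ _ _ i∈both

another : ∀ {f} → Fin (suc (suc f)) → Fin (suc (suc f))
another zero    = suc zero
another (suc _) = zero

another-≢ : ∀ {f} (c : Fin (suc (suc f))) → another c ≢ c
another-≢ zero    ()
another-≢ (suc _) ()

module CoveringToColouring {n k f} {G : Graph n} (𝓕 : CompleteSystem (suc k) (suc (suc f)))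
                           (C : OrientationCovering G (suc k)) where
  open CompleteSystem 𝓕
  open OrientationCovering C

  adj? : ∀ u v → Dec (adj G u v ≡ true)
  adj? u v = adj G u v Bool.≟ true

  leaves : Fin n → Fin n → Fin (suc k) → Bool
  leaves u v i = arc (orient i) u v

  out : Fin n → Fin n → Subset (suc k)
  out u v = tabulate (leaves u v)

  ∈out : ∀ {u v i} → arc (orient i) u v ≡ true → i ∈ out u v
  ∈out {u} {v} {i} uv∈i = VecP.lookup⇒[]= i _ (trans (VecP.lookup∘tabulate (leaves u v) i) uv∈i)

  out-reverse : ∀ {u v} → adj G u v ≡ true → out v u ≡ ∁ (out u v)
  out-reverse {u} {v} uv = trans (VecP.tabulate-cong reversed) (VecP.tabulate-∘ not (leaves u v))
    where
    reversed : ∀ i → arc (orient i) v u ≡ not (arc (orient i) u v)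
    reversed i with directed (orient i) u v uv
    ... | inj₁ (forward , backward) rewrite forward | backward = refl
    ... | inj₂ (forward , backward) rewrite forward | backward = refl

  out-meets : ∀ {u v w} → adj G u v ≡ true → adj G u w ≡ true → v ≢ w → out u v meets out u w
  out-meets {u} {v} {w} uv uw v≢w with covers u v w uv uw v≢w
  ... | i , uv∈i , uw∈i = i , x∈p∩q⁺ (∈out uv∈i , ∈out uw∈i)

  -- A vertex is good when each of its edges leaves it in some orientation; then its out-sets
  -- form an intersecting family.  Otherwise it is pendant: some edge never leaves it.
  Good : Fin n → Set
  Good u = ∀ v → adj G u v ≡ true → Nonempty (out u v)

  Pendant : Fin n → Set
  Pendant u = ∃ λ v → adj G u v ≡ true × Empty (out u v)

  status : ∀ u → Good u ⊎ Pendant u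
  status u with FinP.all? (λ v → adj? u v →-dec nonempty? (out u v))
  ... | yes good = inj₁ good
  ... | no ¬good with FinP.¬∀⟶∃¬ n _ (λ v → adj? u v →-dec nonempty? (out u v)) ¬good
  ...   | v , ¬edge⇒nonempty = inj₂ (v , refuted-implication (adj? u v) ¬edge⇒nonempty)

  good-meets : ∀ {u} → Good u → ∀ v w → adj G u v ≡ true → adj G u w ≡ true → out u v meets out u w
  good-meets good v w uv uw with v FinP.≟ w
  ... | yes refl = nonempty-meets-itself (good v uv)
  ... | no  v≢w  = out-meets uv uw v≢w

  -- A pendant vertex u whose edge to v never leaves u has v as its only neighbour ...
  pendant-unique : ∀ {u v w} → adj G u v ≡ true → Empty (out u v) → adj G u w ≡ true → w ≡ v
  pendant-unique {v = v} {w} uv empty uw with w FinP.≟ v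
  ... | yes w≡v = w≡v
  ... | no  w≢v = ⊥-elim (empty (meets⇒nonemptyˡ (out-meets uv uw (w≢v ∘ sym))))

  -- ... and v is good: vu leaves v in every orientation, so it meets every out-set at v.
  pendant-partner-good : ∀ {u v} → adj G u v ≡ true → Empty (out u v) → Good v
  pendant-partner-good {u} {v} uv empty x vx with x FinP.≟ u
  ... | yes refl = zero , subst (zero ∈_) (sym (out-reverse uv)) (x∉p⇒x∈∁p (λ 0∈ → empty (zero , 0∈)))
  ... | no  x≢u  = meets⇒nonemptyʳ (out-meets (adjacent-sym G uv) vx (x≢u ∘ sym))

  Fits : Fin n → Fin (suc (suc f)) → Set
  Fits u c = ∀ v → adj G u v ≡ true → Member c (out u v)

  fits? : ∀ u c → Dec (Fits u c)
  fits? u c = FinP.all? λ v → adj? u v →-dec member? c (out u v)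

  firstFit : Fin n → Fin (suc (suc f))
  firstFit u with FinP.any? (fits? u)
  ... | yes (c , _) = c
  ... | no  _       = zero

  -- At a good vertex the out-sets are intersecting, so some family absorbs them.
  firstFit-fits : ∀ {u} → Good u → Fits u (firstFit u)
  firstFit-fits {u} good with FinP.any? (fits? u)
  ... | yes (_ , fits) = fits
  ... | no  none       = ⊥-elim (none (absorb 𝓕 (adj? u) (out u) (good-meets good)))

  -- Good vertices take their first fitting colour; a pendant vertex avoids the colour of its
  -- unique neighbour, which is good.
  colourBy : ∀ u → Good u ⊎ Pendant u → Fin (suc (suc f))
  colourBy u (inj₁ _)       = firstFit u
  colourBy u (inj₂ (v , _)) = another (firstFit v)

  -- Adjacent good vertices: their out-sets are complementary, and no family holds both.
  good-proper : ∀ {u w} → adj G u w ≡ true → Good u → Good w → firstFit u ≢ firstFit w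
  good-proper {u} {w} uw good-u good-w same = complement-free 𝓕 (firstFit u) uw∈c wu∈c
    where
    uw∈c : Member (firstFit u) (out u w)
    uw∈c = firstFit-fits good-u w uw
    wu∈c : Member (firstFit u) (∁ (out u w))
    wu∈c = subst₂ Member (sym same) (out-reverse uw) (firstFit-fits good-w u (adjacent-sym G uw))

  proper-by : ∀ u w → adj G u w ≡ true → ∀ su sw → colourBy u su ≢ colourBy w sw
  proper-by u w uw (inj₁ good-u) (inj₁ good-w) = good-proper uw good-u good-w
  proper-by u w uw (inj₁ _) (inj₂ (x , wx , empty)) with pendant-unique wx empty (adjacent-sym G uw)
  ... | refl = another-≢ (firstFit u) ∘ sym
  proper-by u w uw (inj₂ (x , ux , empty)) (inj₁ _) with pendant-unique ux empty uw
  ... | refl = another-≢ (firstFit w)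
  proper-by u w uw (inj₂ (x , ux , empty)) (inj₂ (y , wy , empty')) with pendant-unique ux empty uw
  ... | refl = ⊥-elim (empty' (pendant-partner-good ux empty y wy))

  colouring : Colouring G (suc (suc f))
  colouring = record
    { colour = λ u → colourBy u (status u)
    ; proper = λ u w uw → proper-by u w uw (status u) (status w)
    }

anyVec? : ∀ {m} n {P : Vec (Fin m) n → Set} → Decidable P → Dec (∃ P)
anyVec? zero    P? = map′ ([] ,_) (λ { ([] , p) → p }) (P? [])
anyVec? (suc n) P? = map′ (λ (x , cs , p) → x ∷ cs , p) (λ { (x ∷ cs , p) → x , cs , p })
                          (FinP.any? λ x → anyVec? n (P? ∘ (x ∷_)))

colourable? : ∀ {n} (G : Graph n) m → Dec (Colouring G m)
colourable? {n} G m = map′ fromVec toVec (anyVec? n proper?)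
  where
  Proper : Vec (Fin m) n → Set
  Proper cs = ∀ u v → adj G u v ≡ true → lookup cs u ≢ lookup cs v
  proper? : Decidable Proper
  proper? cs = FinP.all? λ u → FinP.all? λ v →
    (adj G u v Bool.≟ true) →-dec ¬? (lookup cs u FinP.≟ lookup cs v)
  fromVec : ∃ Proper → Colouring G m
  fromVec (cs , ok) = record { colour = lookup cs ; proper = ok }
  toVec : Colouring G m → ∃ Proper
  toVec κ = tabulate colour , λ u v uv same → proper u v uv
    (trans (sym (VecP.lookup∘tabulate colour u)) (trans same (VecP.lookup∘tabulate colour v)))
    where open Colouring κ

least : ∀ {P : ℕ → Set} → Decidable P → (∀ {a b} → a ≤ b → P a → P b) →
        ∀ N → P N → ∃ λ c → c ≤ N × P c × (∀ m → m < c → ¬ P m)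
least P? up zero    p = zero , z≤n , p , λ _ ()
least P? up (suc N) p with P? N
... | yes q = let (c , c≤N , pc , below) = least P? up N q in c , ℕP.m≤n⇒m≤1+n c≤N , pc , below
... | no ¬q = suc N , ℕP.≤-refl , p , λ m m<1+N pm → ¬q (up (ℕP.≤-pred m<1+N) pm)

sigma-band : ∀ {n k f f'} (G : Graph n) →
             OrientationCovering G k ⇔ Colouring G f →
             OrientationCovering G (suc k) ⇔ Colouring G f' →
             IsSigma G (suc k) ⇔ ∃ λ c → IsChromaticNumber G c × suc f ≤ c × c ≤ f'
sigma-band {k = k} {f} {f'} G σ≤k σ≤k+1 = mk⇔ forward backward
  where
  open Equivalence
  forward : IsSigma G (suc k) → ∃ λ c → IsChromaticNumber G c × suc f ≤ c × c ≤ f'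
  forward (C , minimal) with least (colourable? G) (colouring-mono G) f' (to σ≤k+1 C)
  ... | c , c≤f' , κ , below with c ℕ.≤? f
  ...   | yes c≤f = ⊥-elim (minimal k (ℕP.n<1+n k) (from σ≤k (colouring-mono G c≤f κ)))
  ...   | no  c≰f = c , (κ , below) , ℕP.≰⇒> c≰f , c≤f'
  backward : (∃ λ c → IsChromaticNumber G c × suc f ≤ c × c ≤ f') → IsSigma G (suc k)
  backward (c , (κ , below) , f<c , c≤f') =
    from σ≤k+1 (colouring-mono G c≤f' κ) ,
    λ m m<1+k C → below f f<c (to σ≤k (covering-mono G (ℕP.≤-pred m<1+k) C))

σ≤⇔χ≤ : ∀ {n k f} (G : Graph n) → CompleteSystem (suc k) (suc (suc f)) →
        OrientationCovering G (suc k) ⇔ Colouring G (suc (suc f))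
σ≤⇔χ≤ G 𝓕 = mk⇔ (CoveringToColouring.colouring 𝓕) (ColouringToCovering.covering 𝓕)

theorem16 : (n : ℕ) (G : Graph n) →
    (IsSigma G 3 ⇔ ∃ λ c → IsChromaticNumber G c × 3 ≤ c × c ≤ 4) ×
    (IsSigma G 4 ⇔ ∃ λ c → IsChromaticNumber G c × 5 ≤ c × c ≤ 12)
theorem16 n G =
  sigma-band G (σ≤⇔χ≤ G system₂) (σ≤⇔χ≤ G system₃) ,
  sigma-band G (σ≤⇔χ≤ G system₃) (σ≤⇔χ≤ G system₄)
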